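{- Let $G$ be a finite set of I/O pairs and $(B,Y)$ a pair. Then: $G\vdash_{OUT_1}(B,Y)$ iff for every I/O model $(\mathit{In},\mathit{out})$ (no restriction on $\mathit{In}$), if all pairs of $G$ are 1-2-valid in it then $(B,Y)$ is 1-2-valid in it; $G\vdash_{OUT_2}(B,Y)$ iff the same holds for all I/O models with $|\mathit{In}|\le1$ (1-2-validity); $G\vdash_{OUT_3}(B,Y)$ iff for every I/O model, 3-4-validity of all pairs of $G$ implies 3-4-validity of $(B,Y)$; $G\vdash_{OUT_4}(B,Y)$ iff the same holds for all I/O models with $|\mathit{In}|\le1$ (3-4-validity).
   Context: Formulas are classical propositional formulas built with $\top,\bot,\neg,\wedge,\vee,\to$; $\models$ denotes classical semantic entailment. An I/O pair is an ordered pair $(A,X)$ of formulas. Rules on pairs: (TOP) $(\top,\top)$ is derivable from no premises; (WO) from $(A,X)$ derive $(A,Y)$ whenever $X\models Y$; (SI) from $(A,X)$ derive $(B,X)$ whenever $B\models A$; (AND) from $(A,X_1)$ and $(A,X_2)$ derive $(A,X_1\wedge X_2)$; (OR) from $(A_1,X)$ and $(A_2,X)$ derive $(A_1\vee A_2,X)$; (CT) from $(A,X)$ and $(A\wedge X,Y)$ derive $(A,Y)$. $OUT_1$ = {TOP, WO, SI, AND}; $OUT_2$ = $OUT_1$ + OR; $OUT_3$ = $OUT_1$ + CT; $OUT_4$ = $OUT_1$ + OR + CT. $G\vdash_{L}(B,Y)$ means there is a finite tree with root $(B,Y)$, each leaf an element of $G$ or an axiom of $L$, and each non-leaf node obtained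 from its children by a rule of $L$. A world is a classical truth-value assignment to propositional variables. An I/O model is a pair $(\mathit{In},\mathit{out})$ where $\mathit{out}$ is a world and $\mathit{In}$ is a (possibly empty) set of worlds. A pair $(A,X)$ is 1-2-valid in $(\mathit{In},\mathit{out})$ if ($\mathit{in}\models A$ for all $\mathit{in}\in\mathit{In}$) implies $\mathit{out}\models X$. It is 3-4-valid if ($\mathit{in}\models A$ for all $\mathit{in}\in\mathit{In}$) implies $w\models X$ for all $w\in\mathit{In}\cup\{\mathit{out}\}$. -}

module Defs where

open import Data.Nat using (ℕ)
open import Data.Bool using (Bool; true; false; not; _∧_; _∨_)
open import Data.Product using (_×_; _,_)
open import Data.List using (List)
open import Data.List.Membership.Propositional using (_∈_)
open import Data.Sum using (_⊎_)
open import Relation.Binary.PropositionalEquality using (_≡_)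

data Formula : Set where
  var : ℕ → Formula
  ⊤f ⊥f : Formula
  ¬f_ : Formula → Formula
  _∧f_ _∨f_ _⇒f_ : Formula → Formula → Formula

World : Set
World = ℕ → Bool

eval : Formula → World → Bool
eval (var n) w = w n
eval ⊤f w = true
eval ⊥f w = false
eval (¬f A) w = not (eval A w)
eval (A ∧f B) w = eval A w ∧ eval B w
eval (A ∨f B) w = eval A w ∨ eval B w
eval (A ⇒f B) w = not (eval A w) ∨ eval B w

_⊩_ : World → Formula → Set
w ⊩ A = eval A w ≡ true

_⊨_ : Formula → Formula → Set
A ⊨ B = ∀ (w : World) → w ⊩ A → w ⊩ B

record Pair : Set where
  constructor ⟨_,_⟩
  field
    inp  : Formula
    outp : Formula

data Logic : Set where
  OUT₁ OUT₂ OUT₃ OUT₄ : Logic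

data HasOR : Logic → Set where
  or₂ : HasOR OUT₂
  or₄ : HasOR OUT₄

data HasCT : Logic → Set where
  ct₃ : HasCT OUT₃
  ct₄ : HasCT OUT₄

data _⊢[_]_ (G : List Pair) (L : Logic) : Pair → Set where
  leaf : ∀ {p} → p ∈ G → G ⊢[ L ] p
  TOP  : G ⊢[ L ] ⟨ ⊤f , ⊤f ⟩
  WO   : ∀ {A X Y} → G ⊢[ L ] ⟨ A , X ⟩ → X ⊨ Y → G ⊢[ L ] ⟨ A , Y ⟩
  SI   : ∀ {A B X} → G ⊢[ L ] ⟨ A , X ⟩ → B ⊨ A → G ⊢[ L ] ⟨ B , X ⟩
  AND  : ∀ {A X₁ X₂} → G ⊢[ L ] ⟨ A , X₁ ⟩ → G ⊢[ L ] ⟨ A , X₂ ⟩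
       → G ⊢[ L ] ⟨ A , X₁ ∧f X₂ ⟩
  OR   : ∀ {A₁ A₂ X} → HasOR L → G ⊢[ L ] ⟨ A₁ , X ⟩ → G ⊢[ L ] ⟨ A₂ , X ⟩
       → G ⊢[ L ] ⟨ A₁ ∨f A₂ , X ⟩
  CT   : ∀ {A X Y} → HasCT L → G ⊢[ L ] ⟨ A , X ⟩ → G ⊢[ L ] ⟨ A ∧f X , Y ⟩
       → G ⊢[ L ] ⟨ A , Y ⟩

-- I/O models: In is an arbitrary (possibly empty, possibly infinite) set of
-- worlds, represented as a predicate on worlds
record Model : Set₁ where
  field
    In  : World → Set
    out : World

open Model public

AtMostOne : Model → Set
AtMostOne M = ∀ w w' → In M w → In M w' → ∀ n → w n ≡ w' n

InSat : Model → Formula → Set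
InSat M A = ∀ w → In M w → w ⊩ A

valid12 : Model → Pair → Set
valid12 M ⟨ A , X ⟩ = InSat M A → out M ⊩ X

valid34 : Model → Pair → Set
valid34 M ⟨ A , X ⟩ = InSat M A → ∀ w → (In M w ⊎ w ≡ out M) → w ⊩ X

AllValid : (Model → Pair → Set) → Model → List Pair → Set
AllValid V M G = ∀ p → p ∈ G → V M p

-- CT is sound for 3-4-validity because that validity
-- makes every input world satisfy the intermediate output, and OR is sound when |In| ≤ 1 because a
-- disjunction holding on at most one world means one disjunct holds on all of In.
--
-- For completeness, let A be an input formula and In a set of worlds such that every input of G
-- holding throughout In is entailed by A.  The pairs of G whose inputs A entails derive (A, X), X the
-- conjunction of their outputs, and the semantic hypothesis for the models (In, o) with o ⊨ X gives
-- X ⊨ Y.  For OUT₁ take In = ⟦B⟧.  For OUT₃ first saturate B under CT to a derivable (B, X) with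
-- B ∧ X closed under G, and take In = ⟦B ∧ X⟧.  For OUT₂ and OUT₄, OR splits B into the cells
-- B ∧ C_α of the assignments α to the finitely many variables of B and G, and In = {α} ∩ ⟦B⟧; in the
-- 3-4 case a cell whose α falsifies some pair of G read as a material implication is instead derived
-- by CT through that pair, since the cell together with its output is inconsistent.
module Submission where

open import Defs
open import Data.Bool using (Bool; true; false; not; _∧_; _∨_)
import Data.Bool.Properties as Bool
open import Data.Empty using (⊥; ⊥-elim)
open import Data.List using (List; []; _∷_; filter; foldr; length)
open import Data.List.Membership.Propositional using (_∈_; lose; find)
open import Data.List.Membership.Propositional.Properties using (∈-filter⁺; ∈-filter⁻)
open import Data.List.Properties using (filter-notAll)
open import Data.List.Relation.Unary.All as All using (all?)
open import Data.List.Relation.Unary.All.Properties using (¬All⇒Any¬)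
open import Data.List.Relation.Unary.Any as Any using (here; there; any?)
open import Data.Nat using (ℕ; zero; suc; _≤_; _<_; _⊔_)
open import Data.Nat.Induction using (<-wellFounded)
open import Data.Nat.Properties
  using (_≟_; <-irrefl; n≤1+n; ≤-refl; ≤-trans; m≤m⊔n; m≤n⊔m; m⊔n≤o⇒m≤o; m⊔n≤o⇒n≤o; m<1+n⇒m<n∨m≡n)
open import Data.Product using (_×_; _,_; proj₁; proj₂)
open import Data.Sum using (_⊎_; inj₁; inj₂; [_,_])
open import Function using (_∘_; id)
open import Function.Bundles using (_⇔_; mk⇔)
open import Induction.WellFounded using (Acc; acc)
open import Relation.Binary.PropositionalEquality using (_≡_; _≗_; refl; sym; trans; cong; cong₂)
open import Relation.Nullary using (¬_; Dec; yes; no; ¬?; _×-dec_; _→-dec_)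
open import Relation.Nullary.Decidable using (decidable-stable)

open Pair

∧-true⁺ : ∀ {a b} → a ≡ true → b ≡ true → a ∧ b ≡ true
∧-true⁺ refl b = b

∧-true⁻ : ∀ {a b} → a ∧ b ≡ true → a ≡ true × b ≡ true
∧-true⁻ {true} b = refl , b

∨-trueˡ : ∀ {a b} → a ≡ true → a ∨ b ≡ true
∨-trueˡ refl = refl

∨-trueʳ : ∀ {a b} → b ≡ true → a ∨ b ≡ true
∨-trueʳ {a} refl = Bool.∨-zeroʳ a

∨-true⁻ : ∀ {a b} → a ∨ b ≡ true → a ≡ true ⊎ b ≡ true
∨-true⁻ {true} _ = inj₁ refl
∨-true⁻ {false} b = inj₂ b

⇒-true⁻ : ∀ {a b} → not a ∨ b ≡ true → a ≡ true → b ≡ true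
⇒-true⁻ b refl = b

⇒-counterexample : ∀ {a b} → ¬ (not a ∨ b ≡ true) → a ≡ true × ¬ b ≡ true
⇒-counterexample {true} ¬b = refl , ¬b
⇒-counterexample {false} ¬⊤ = ⊥-elim (¬⊤ refl)

_⊩?_ : ∀ w A → Dec (w ⊩ A)
w ⊩? A = eval A w Bool.≟ true

⊩-∧⁻ : ∀ {w} A B → w ⊩ (A ∧f B) → w ⊩ A × w ⊩ B
⊩-∧⁻ A B = ∧-true⁻

bound : Formula → ℕ
bound (var n) = suc n
bound ⊤f = 0
bound ⊥f = 0
bound (¬f A) = bound A
bound (A ∧f B) = bound A ⊔ bound B
bound (A ∨f B) = bound A ⊔ bound B
bound (A ⇒f B) = bound A ⊔ bound B

Agree : ℕ → World → World → Set
Agree n w w' = ∀ i → i < n → w i ≡ w' i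

agree-sym : ∀ {n w w'} → Agree n w w' → Agree n w' w
agree-sym ag i i<n = sym (ag i i<n)

agree-trans : ∀ {n u v w} → Agree n u v → Agree n v w → Agree n u w
agree-trans ag ag' i i<n = trans (ag i i<n) (ag' i i<n)

eval-agree : ∀ A {n w w'} → bound A ≤ n → Agree n w w' → eval A w ≡ eval A w'
eval-agree (var m) A≤n ag = ag m A≤n
eval-agree ⊤f A≤n ag = refl
eval-agree ⊥f A≤n ag = refl
eval-agree (¬f A) A≤n ag = cong not (eval-agree A A≤n ag)
eval-agree (A ∧f B) A≤n ag =
  cong₂ _∧_ (eval-agree A (m⊔n≤o⇒m≤o _ _ A≤n) ag) (eval-agree B (m⊔n≤o⇒n≤o _ _ A≤n) ag)
eval-agree (A ∨f B) A≤n ag =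
  cong₂ _∨_ (eval-agree A (m⊔n≤o⇒m≤o _ _ A≤n) ag) (eval-agree B (m⊔n≤o⇒n≤o _ _ A≤n) ag)
eval-agree (A ⇒f B) A≤n ag =
  cong₂ (λ a b → not a ∨ b) (eval-agree A (m⊔n≤o⇒m≤o _ _ A≤n) ag) (eval-agree B (m⊔n≤o⇒n≤o _ _ A≤n) ag)

⊩-agree : ∀ A {n w w'} → bound A ≤ n → Agree n w w' → w ⊩ A → w' ⊩ A
⊩-agree A A≤n ag w⊩A = trans (sym (eval-agree A A≤n ag)) w⊩A

⊩-≗ : ∀ A {w w'} → w ≗ w' → w ⊩ A → w' ⊩ A
⊩-≗ A w≗w' = ⊩-agree A ≤-refl (λ i _ → w≗w' i)

_[_≔_] : World → ℕ → Bool → World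
(w [ n ≔ b ]) i with i ≟ n
... | yes _ = b
... | no _ = w i

update-≡ : ∀ w n b → (w [ n ≔ b ]) n ≡ b
update-≡ w n b with n ≟ n
... | yes _ = refl
... | no n≢n = ⊥-elim (n≢n refl)

update-< : ∀ w n b → Agree n (w [ n ≔ b ]) w
update-< w n b i i<n with i ≟ n
... | yes refl = ⊥-elim (<-irrefl refl i<n)
... | no _ = refl

agree-suc : ∀ {n w w'} → Agree n w w' → w n ≡ w' n → Agree (suc n) w w'
agree-suc ag eq i i<1+n with m<1+n⇒m<n∨m≡n i<1+n
... | inj₁ i<n = ag i i<n
... | inj₂ refl = eq

agree-update : ∀ {n w α b} → Agree n w α → w n ≡ b → Agree (suc n) w (α [ n ≔ b ])
agree-update {n} {α = α} {b} ag wn≡b =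
  agree-suc (agree-trans ag (agree-sym (update-< α n b))) (trans wn≡b (sym (update-≡ α n b)))

∀-local? : ∀ n {P : World → Set} → (∀ {w w'} → Agree n w w' → P w → P w') →
           (∀ w → Dec (P w)) → Dec (∀ w → P w)
∀-local? zero local P? with P? (λ _ → false)
... | yes p = yes (λ w → local (λ _ ()) p)
... | no ¬p = no (λ ∀P → ¬p (∀P _))
∀-local? (suc n) {P} local P?
  with ∀-local? n local-both (λ w → P? (w [ n ≔ true ]) ×-dec P? (w [ n ≔ false ]))
  where
  local-both : ∀ {w w'} → Agree n w w' →
               P (w [ n ≔ true ]) × P (w [ n ≔ false ]) → P (w' [ n ≔ true ]) × P (w' [ n ≔ false ])
  local-both {w} {w'} ag (pt , pf) = local (shift true) pt , local (shift false) pf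
    where
    shift : ∀ b → Agree (suc n) (w [ n ≔ b ]) (w' [ n ≔ b ])
    shift b = agree-update (agree-trans (update-< w n b) ag) (update-≡ w n b)
... | yes both = yes (λ w → local (agree-sym (agree-update (λ _ _ → refl) refl)) (choose (w n) (both w)))
  where
  choose : ∀ {w} b → P (w [ n ≔ true ]) × P (w [ n ≔ false ]) → P (w [ n ≔ b ])
  choose true = proj₁
  choose false = proj₂
... | no ¬both = no (λ ∀P → ¬both (λ w → ∀P _ , ∀P _))

_⊨?_ : ∀ A B → Dec (A ⊨ B)
A ⊨? B = ∀-local? (bound A ⊔ bound B) local (λ w → (w ⊩? A) →-dec (w ⊩? B))
  where
  local : ∀ {w w'} → Agree (bound A ⊔ bound B) w w' → (w ⊩ A → w ⊩ B) → w' ⊩ A → w' ⊩ B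
  local ag A⇒B w'⊩A =
    ⊩-agree B (m≤n⊔m (bound A) _) ag (A⇒B (⊩-agree A (m≤m⊔n _ (bound B)) (agree-sym ag) w'⊩A))

-- The case split on A₁ is only available under ¬¬, which is harmless since the conclusion is a
-- decidable boolean equation.
InSat-∨-elim : ∀ {M A₁ A₂ a} → AtMostOne M → InSat M (A₁ ∨f A₂) →
               (InSat M A₁ → a ≡ true) → (InSat M A₂ → a ≡ true) → a ≡ true
InSat-∨-elim {M} {A₁} {A₂} {a} one sat k₁ k₂ = decidable-stable (a Bool.≟ true) (λ ¬a → ¬a (k₁ (only-A₁ ¬a)))
  where
  only-A₁ : ¬ a ≡ true → InSat M A₁
  only-A₁ ¬a w w∈ with ∨-true⁻ (sat w w∈)
  ... | inj₁ w⊩A₁ = w⊩A₁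
  ... | inj₂ w⊩A₂ = ⊥-elim (¬a (k₂ (λ w' w'∈ → ⊩-≗ A₂ (one w w' w∈ w'∈) w⊩A₂)))

module _ {L G} (M : Model) (one : HasOR L → AtMostOne M) (noCT : ¬ HasCT L)
         (valid : AllValid valid12 M G) where

  sound₁₂ : ∀ {p} → G ⊢[ L ] p → valid12 M p
  sound₁₂ (leaf p∈G) = valid _ p∈G
  sound₁₂ TOP _ = refl
  sound₁₂ (WO d X⊨Y) sat = X⊨Y (out M) (sound₁₂ d sat)
  sound₁₂ (SI d B⊨A) sat = sound₁₂ d (λ w w∈ → B⊨A w (sat w w∈))
  sound₁₂ (AND d₁ d₂) sat = ∧-true⁺ (sound₁₂ d₁ sat) (sound₁₂ d₂ sat)
  sound₁₂ (OR {A₁} {A₂} or d₁ d₂) sat = InSat-∨-elim {M} {A₁} {A₂} (one or) sat (sound₁₂ d₁) (sound₁₂ d₂)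
  sound₁₂ (CT ct _ _) = ⊥-elim (noCT ct)

module _ {L G} (M : Model) (one : HasOR L → AtMostOne M) (valid : AllValid valid34 M G) where

  sound₃₄ : ∀ {p} → G ⊢[ L ] p → valid34 M p
  sound₃₄ (leaf p∈G) = valid _ p∈G
  sound₃₄ TOP _ _ _ = refl
  sound₃₄ (WO d X⊨Y) sat w w∈ = X⊨Y w (sound₃₄ d sat w w∈)
  sound₃₄ (SI d B⊨A) sat = sound₃₄ d (λ w w∈ → B⊨A w (sat w w∈))
  sound₃₄ (AND d₁ d₂) sat w w∈ = ∧-true⁺ (sound₃₄ d₁ sat w w∈) (sound₃₄ d₂ sat w w∈)
  sound₃₄ (OR {A₁} {A₂} or d₁ d₂) sat w w∈ =
    InSat-∨-elim {M} {A₁} {A₂} (one or) sat (λ s → sound₃₄ d₁ s w w∈) (λ s → sound₃₄ d₂ s w w∈)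
  sound₃₄ (CT _ d₁ d₂) sat =
    sound₃₄ d₂ (λ w w∈ → ∧-true⁺ (sat w w∈) (sound₃₄ d₁ sat w (inj₁ w∈)))

outputs : List Pair → Formula
outputs [] = ⊤f
outputs (q ∷ S) = outp q ∧f outputs S

⊩-outputs : ∀ {w q S} → w ⊩ outputs S → q ∈ S → w ⊩ outp q
⊩-outputs h (here refl) = proj₁ (∧-true⁻ h)
⊩-outputs {S = _ ∷ _} h (there q∈S) = ⊩-outputs (proj₂ (∧-true⁻ h)) q∈S

⊢-outputs : ∀ {L G A} S → (∀ {q} → q ∈ S → G ⊢[ L ] ⟨ A , outp q ⟩) → G ⊢[ L ] ⟨ A , outputs S ⟩
⊢-outputs [] _ = SI TOP (λ _ _ → refl)
⊢-outputs (q ∷ S) ⊢S = AND (⊢S (here refl)) (⊢-outputs S (⊢S ∘ there))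

entailed : Formula → List Pair → List Pair
entailed A = filter (λ q → A ⊨? inp q)

∈-entailed : ∀ {A q G} → q ∈ G → A ⊨ inp q → q ∈ entailed A G
∈-entailed {A} = ∈-filter⁺ (λ q → A ⊨? inp q)

⊢-entailed : ∀ {L A} G → G ⊢[ L ] ⟨ A , outputs (entailed A G) ⟩
⊢-entailed {A = A} G = ⊢-outputs (entailed A G) λ q∈ →
  let q∈G , A⊨q = ∈-filter⁻ (λ q → A ⊨? inp q) q∈ in SI (leaf q∈G) A⊨q

model : (World → Set) → World → Model
model I o = record { In = I ; out = o }

Generic : List Pair → Formula → (World → Set) → Set
Generic G A I = ∀ {q} → q ∈ G → (∀ w → I w → w ⊩ inp q) → A ⊨ inp q

Closed : List Pair → Formula → (World → Set) → Set
Closed G A I = ∀ {q} → q ∈ G → A ⊨ inp q → ∀ w → I w → w ⊩ outp q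

complete₁₂ : ∀ {L G A Y} I → Generic G A I →
             (∀ o → AllValid valid12 (model I o) G → o ⊩ Y) → G ⊢[ L ] ⟨ A , Y ⟩
complete₁₂ {G = G} {A} I generic sem =
  WO (⊢-entailed G) λ o o⊩ → sem o λ _ q∈G sat → ⊩-outputs o⊩ (∈-entailed {A} q∈G (generic q∈G sat))

complete₃₄ : ∀ {L G A Y} I → Generic G A I → Closed G A I →
             (∀ o → AllValid valid34 (model I o) G → o ⊩ Y) → G ⊢[ L ] ⟨ A , Y ⟩
complete₃₄ {G = G} {A} I generic closed sem = WO (⊢-entailed G) λ o o⊩ → sem o (valid o⊩)
  where
  valid : ∀ {o} → o ⊩ outputs (entailed A G) → AllValid valid34 (model I o) G
  valid o⊩ _ q∈G sat w (inj₁ w∈I) = closed q∈G (generic q∈G sat) w w∈I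
  valid o⊩ _ q∈G sat w (inj₂ refl) = ⊩-outputs o⊩ (∈-entailed {A} q∈G (generic q∈G sat))

completeness₁ : ∀ {G B Y} → (∀ M → AllValid valid12 M G → valid12 M ⟨ B , Y ⟩) → G ⊢[ OUT₁ ] ⟨ B , Y ⟩
completeness₁ {B = B} sem =
  complete₁₂ (_⊩ B) (λ _ sat → sat) (λ o valid → sem (model (_⊩ B) o) valid (λ _ w⊩B → w⊩B))

record Saturation (G : List Pair) (B : Formula) : Set where
  field
    X         : Formula
    derivable : G ⊢[ OUT₃ ] ⟨ B , X ⟩
    closed    : Closed G (B ∧f X) (_⊩ (B ∧f X))

module _ (G : List Pair) (B : Formula) where

  private
    fires : ∀ X q → Dec ((B ∧f X) ⊨ inp q)
    fires X q = (B ∧f X) ⊨? inp q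

  saturate : ∀ X R → Acc _<_ (length R) → G ⊢[ OUT₃ ] ⟨ B , X ⟩ → (∀ {q} → q ∈ R → q ∈ G) →
             (∀ {q} → q ∈ G → q ∈ R ⊎ X ⊨ outp q) → Saturation G B
  saturate X R (acc smaller) ⊢X R⊆G absorbed with any? (fires X) R
  ... | no none = record { X = X ; derivable = ⊢X ; closed = closed }
    where
    closed : Closed G (B ∧f X) (_⊩ (B ∧f X))
    closed q∈G fired w w⊩ =
      [ (λ q∈R → ⊥-elim (none (lose q∈R fired))) , (λ X⊨ → X⊨ w (proj₂ (∧-true⁻ w⊩))) ] (absorbed q∈G)
  ... | yes some =
    saturate (X ∧f outputs now) later (smaller shorter) (AND ⊢X ⊢now)
      (R⊆G ∘ proj₁ ∘ ∈-filter⁻ (¬? ∘ fires X)) absorbed′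
    where
    now = filter (fires X) R
    later = filter (¬? ∘ fires X) R

    shorter : length later < length R
    shorter = filter-notAll (¬? ∘ fires X) R (Any.map (λ p ¬p → ¬p p) some)

    ⊢now : G ⊢[ OUT₃ ] ⟨ B , outputs now ⟩
    ⊢now = ⊢-outputs now λ q∈now →
      let q∈R , fired = ∈-filter⁻ (fires X) q∈now in CT ct₃ ⊢X (SI (leaf (R⊆G q∈R)) fired)

    absorbed′ : ∀ {q} → q ∈ G → q ∈ later ⊎ (X ∧f outputs now) ⊨ outp q
    absorbed′ {q} q∈G with absorbed q∈G
    ... | inj₂ X⊨ = inj₂ (λ w w⊩ → X⊨ w (proj₁ (∧-true⁻ w⊩)))
    ... | inj₁ q∈R with fires X q
    ...   | yes fired = inj₂ (λ w w⊩ → ⊩-outputs (proj₂ (∧-true⁻ w⊩)) (∈-filter⁺ (fires X) q∈R fired))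
    ...   | no ¬fired = inj₁ (∈-filter⁺ (¬? ∘ fires X) q∈R ¬fired)

  saturation : Saturation G B
  saturation = saturate ⊤f G (<-wellFounded _) (SI TOP (λ _ _ → refl)) id inj₁

completeness₃ : ∀ {G B Y} → (∀ M → AllValid valid34 M G → valid34 M ⟨ B , Y ⟩) → G ⊢[ OUT₃ ] ⟨ B , Y ⟩
completeness₃ {G} {B} sem =
  CT ct₃ derivable (complete₃₄ (_⊩ (B ∧f X)) (λ _ sat → sat) closed
    (λ o valid → sem (model _ o) valid (λ _ w⊩ → proj₁ (∧-true⁻ w⊩)) o (inj₂ refl)))
  where open Saturation (saturation G B)

literal : ℕ → Bool → Formula
literal i true = var i
literal i false = ¬f var i

⊩-literal⁺ : ∀ {w i b} → w i ≡ b → w ⊩ literal i b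
⊩-literal⁺ {b = true} wi = wi
⊩-literal⁺ {b = false} wi = cong not wi

⊩-literal⁻ : ∀ {w i} b → w ⊩ literal i b → w i ≡ b
⊩-literal⁻ true wi = wi
⊩-literal⁻ {w} {i} false ¬wi = trans (sym (Bool.not-involutive (w i))) (cong not ¬wi)

cell : ℕ → World → Formula
cell zero α = ⊤f
cell (suc n) α = literal n (α n) ∧f cell n α

⊩-cell⁺ : ∀ {n w α} → Agree n w α → w ⊩ cell n α
⊩-cell⁺ {zero} _ = refl
⊩-cell⁺ {suc n} ag = ∧-true⁺ (⊩-literal⁺ (ag n ≤-refl)) (⊩-cell⁺ (λ i i<n → ag i (≤-trans i<n (n≤1+n n))))

⊩-cell⁻ : ∀ n α {w} → w ⊩ cell n α → Agree n w α
⊩-cell⁻ (suc n) α w⊩ = agree-suc (⊩-cell⁻ n α (proj₂ (∧-true⁻ w⊩))) (⊩-literal⁻ (α n) (proj₁ (∧-true⁻ w⊩)))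

⊢-split : ∀ {L G A Y} → HasOR L → ∀ n → (∀ α → G ⊢[ L ] ⟨ A ∧f cell n α , Y ⟩) → G ⊢[ L ] ⟨ A , Y ⟩
⊢-split or zero ⊢cell = SI (⊢cell (λ _ → false)) (λ _ w⊩A → ∧-true⁺ w⊩A refl)
⊢-split {A = A} or (suc n) ⊢cell =
  ⊢-split or n λ α → SI (OR or (⊢cell (α [ n ≔ true ])) (⊢cell (α [ n ≔ false ]))) (covered α)
  where
  refine : ∀ {α w b} → w ⊩ (A ∧f cell n α) → w n ≡ b → w ⊩ (A ∧f cell (suc n) (α [ n ≔ b ]))
  refine {α} w⊩ wn with ⊩-∧⁻ A (cell n α) w⊩
  ... | w⊩A , w⊩cell = ∧-true⁺ w⊩A (⊩-cell⁺ (agree-update (⊩-cell⁻ n α w⊩cell) wn))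

  covered : ∀ α → (A ∧f cell n α) ⊨
                  ((A ∧f cell (suc n) (α [ n ≔ true ])) ∨f (A ∧f cell (suc n) (α [ n ≔ false ])))
  covered α w w⊩ with w n in wn
  ... | true = ∨-trueˡ (refine w⊩ wn)
  ... | false = ∨-trueʳ (refine w⊩ wn)

pairsBound : List Pair → ℕ
pairsBound = foldr (λ q m → bound (inp q) ⊔ bound (outp q) ⊔ m) 0

pairsBound-∈ : ∀ {q G} → q ∈ G → bound (inp q) ⊔ bound (outp q) ≤ pairsBound G
pairsBound-∈ (here refl) = m≤m⊔n _ _
pairsBound-∈ {G = p ∷ _} (there q∈G) = ≤-trans (pairsBound-∈ q∈G) (m≤n⊔m (bound (inp p) ⊔ bound (outp p)) _)

module _ {G : List Pair} {B Y : Formula} where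

  private
    n : ℕ
    n = bound B ⊔ pairsBound G

    B≤n : bound B ≤ n
    B≤n = m≤m⊔n _ _

    inp≤n : ∀ {q} → q ∈ G → bound (inp q) ≤ n
    inp≤n q∈G = ≤-trans (m⊔n≤o⇒m≤o _ _ (pairsBound-∈ q∈G)) (m≤n⊔m (bound B) _)

    outp≤n : ∀ {q} → q ∈ G → bound (outp q) ≤ n
    outp≤n q∈G = ≤-trans (m⊔n≤o⇒n≤o _ _ (pairsBound-∈ q∈G)) (m≤n⊔m (bound B) _)

    in-cell : ∀ {α w} → w ⊩ (B ∧f cell n α) → Agree n w α
    in-cell {α} w⊩ = ⊩-cell⁻ n α (proj₂ (⊩-∧⁻ B (cell n α) w⊩))

    point : World → World → Set
    point α w = w ≗ α × w ⊩ B

    point-one : ∀ α o → AtMostOne (model (point α) o)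
    point-one _ _ _ _ (w≗α , _) (w'≗α , _) i = trans (w≗α i) (sym (w'≗α i))

    point-generic : ∀ α → Generic G (B ∧f cell n α) (point α)
    point-generic α {q} q∈G sat w w⊩ = ⊩-agree (inp q) (inp≤n q∈G) (agree-sym (in-cell w⊩)) α⊩inp
      where
      α⊩inp = sat α ((λ _ → refl) , ⊩-agree B B≤n (in-cell w⊩) (proj₁ (⊩-∧⁻ B (cell n α) w⊩)))

  completeness₂ : (∀ M → AtMostOne M → AllValid valid12 M G → valid12 M ⟨ B , Y ⟩) → G ⊢[ OUT₂ ] ⟨ B , Y ⟩
  completeness₂ sem = ⊢-split or₂ n λ α →
    complete₁₂ (point α) (point-generic α) λ o valid →
      sem (model (point α) o) (point-one α o) valid (λ _ → proj₂)

  completeness₄ : (∀ M → AtMostOne M → AllValid valid34 M G → valid34 M ⟨ B , Y ⟩) → G ⊢[ OUT₄ ] ⟨ B , Y ⟩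
  completeness₄ sem = ⊢-split or₄ n cell-derivation
    where
    ⊢-unsatisfiable : ∀ {A} → A ⊨ ⊥f → G ⊢[ OUT₄ ] ⟨ A , Y ⟩
    ⊢-unsatisfiable {A} A⊨⊥ = complete₃₄ (λ _ → ⊥) generic (λ _ _ _ ())
      (λ o valid → sem (model _ o) (λ _ _ ()) valid (λ _ ()) o (inj₂ refl))
      where
      generic : Generic G A (λ _ → ⊥)
      generic _ _ w w⊩A with A⊨⊥ w w⊩A
      ... | ()

    material? : ∀ α q → Dec (α ⊩ (inp q ⇒f outp q))
    material? α q = α ⊩? (inp q ⇒f outp q)

    cell-derivation : ∀ α → G ⊢[ OUT₄ ] ⟨ B ∧f cell n α , Y ⟩
    cell-derivation α with all? (material? α) G
    ... | yes respected = complete₃₄ (point α) (point-generic α) closed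
          (λ o valid → sem (model (point α) o) (point-one α o) valid (λ _ → proj₂) o (inj₂ refl))
      where
      closed : Closed G (B ∧f cell n α) (point α)
      closed {q} q∈G entails w (w≗α , w⊩B) =
        ⊩-≗ (outp q) (sym ∘ w≗α) (⇒-true⁻ (All.lookup respected q∈G) α⊩inp)
        where
        α⊩inp = entails α (∧-true⁺ (⊩-≗ B w≗α w⊩B) (⊩-cell⁺ {n} (λ _ _ → refl)))
    ... | no ¬respected with find (¬All⇒Any¬ (material? α) G ¬respected)
    ...   | q , q∈G , violated with ⇒-counterexample violated
    ...     | α⊩inp , α⊮outp = CT ct₄ (SI (leaf q∈G) forces-inp) (⊢-unsatisfiable refutes-outp)
      where
      forces-inp : (B ∧f cell n α) ⊨ inp q
      forces-inp w w⊩ = ⊩-agree (inp q) (inp≤n q∈G) (agree-sym (in-cell w⊩)) α⊩inp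

      refutes-outp : ((B ∧f cell n α) ∧f outp q) ⊨ ⊥f
      refutes-outp w w⊩ with ⊩-∧⁻ (B ∧f cell n α) (outp q) w⊩
      ... | w⊩cell , w⊩outp = ⊥-elim (α⊮outp (⊩-agree (outp q) (outp≤n q∈G) (in-cell w⊩cell) w⊩outp))

proposition2 : (G : List Pair) (p : Pair) →
    ((G ⊢[ OUT₁ ] p) ⇔ (∀ (M : Model) → AllValid valid12 M G → valid12 M p))
    × ((G ⊢[ OUT₂ ] p) ⇔ (∀ (M : Model) → AtMostOne M → AllValid valid12 M G → valid12 M p))
    × ((G ⊢[ OUT₃ ] p) ⇔ (∀ (M : Model) → AllValid valid34 M G → valid34 M p))
    × ((G ⊢[ OUT₄ ] p) ⇔ (∀ (M : Model) → AtMostOne M → AllValid valid34 M G → valid34 M p))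
proposition2 G p =
    mk⇔ (λ d M valid → sound₁₂ M (λ ()) (λ ()) valid d) completeness₁
  , mk⇔ (λ d M one valid → sound₁₂ M (λ _ → one) (λ ()) valid d) completeness₂
  , mk⇔ (λ d M valid → sound₃₄ M (λ ()) valid d) completeness₃
  , mk⇔ (λ d M one valid → sound₃₄ M (λ _ → one) valid d) completeness₄
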